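{- Let $S[1..n]$ be a string, $k\geq1$, and $\Gamma$ a $k$-attractor of $S$. Then $(\Gamma\setminus\{j\})\cup\{j'\}$ is a $k$-attractor of $S$ for every $j\in\Gamma$ and every $j'\in[1..n]$ with $j'\equiv_k j$.
   Context: $\Gamma\subseteq[1..n]$ is a $k$-attractor of $S$ if every substring $S[i..j]$ with $i\leq j<i+k$ has an occurrence $S[i'..j']=S[i..j]$ with $j''\in[i'..j']$ for some $j''\in\Gamma$. Two positions $i,j\in[1..n]$ satisfy $i\equiv_k j$ iff $S''[i-k+1..i+k-1]=S''[j-k+1..j+k-1]$, where $S''[p]=\#$ (a symbol not in the alphabet) if $p<1$ or $p>n$ and $S''[p]=S[p]$ otherwise. -}

module Defs where

open import Data.Nat using (ℕ; zero; suc; _+_; _∸_; _≤_; _<_; _<?_)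
open import Data.Fin using (Fin; fromℕ<)
open import Data.Integer as ℤ using (ℤ; +_; -[1+_])
open import Data.Maybe using (Maybe; just; nothing)
open import Data.Product using (Σ; ∃; _×_; _,_)
open import Data.Sum using (_⊎_)
open import Relation.Nullary using (¬_; yes; no)
open import Relation.Binary.PropositionalEquality using (_≡_; _≢_)

-- A string S[1..n] over alphabet A is a function Fin n → A
-- (S[p] for 1-based position p is S at index p-1).

-- 1-based character access; nothing plays the role of the symbol #
-- for positions outside [1..n].
at : {A : Set} {n : ℕ} → (Fin n → A) → ℕ → Maybe A
at {n = n} S zero = nothing
at {n = n} S (suc p) with p <? n
... | yes p<n = just (S (fromℕ< p<n))
... | no _ = nothing

ext : {A : Set} {n : ℕ} → (Fin n → A) → ℤ → Maybe A
ext S (+ p) = at S p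
ext S -[1+ _ ] = nothing

PosSet : Set₁
PosSet = ℕ → Set

_⊆[1‥_] : PosSet → ℕ → Set
Γ ⊆[1‥ n ] = ∀ p → Γ p → 1 ≤ p × p ≤ n

SameSubstring : {A : Set} {n : ℕ} → (Fin n → A) → ℕ → ℕ → ℕ → ℕ → Set
SameSubstring S i j i' j' = (j' ∸ i' ≡ j ∸ i) × (∀ t → t ≤ j ∸ i → at S (i' + t) ≡ at S (i + t))

IsAttractor : {A : Set} {n : ℕ} → ℕ → (Fin n → A) → PosSet → Set
IsAttractor {n = n} k S Γ =
  Γ ⊆[1‥ n ] ×
  (∀ i j → 1 ≤ i → i ≤ j → j ≤ n → j < i + k →
     Σ ℕ λ i' → Σ ℕ λ j' → 1 ≤ i' × i' ≤ j' × j' ≤ n × SameSubstring S i j i' j' ×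
       Σ ℕ λ g → Γ g × i' ≤ g × g ≤ j')

Equivₖ : {A : Set} {n : ℕ} → ℕ → (Fin n → A) → ℕ → ℕ → Set
Equivₖ k S i j = ∀ (d : ℤ) → (ℤ.- (+ k) ℤ.+ + 1) ℤ.≤ d → d ℤ.≤ (+ k ℤ.- + 1) →
  ext S (+ i ℤ.+ d) ≡ ext S (+ j ℤ.+ d)

swapPos : PosSet → ℕ → ℕ → PosSet
swapPos Γ j j' p = (Γ p × p ≢ j) ⊎ p ≡ j'

module Submission where

-- Let S[i..e] be a substring of length at most k and S[i'..e'] an occurrence
-- of it that contains an attractor position g.  If g ≠ j, the same occurrence
-- still contains a position of (Γ \ {j}) ∪ {j'}.  If g = j, every position p
-- of S[i'..e'] lies at distance < k from j, so the window condition j' ≡_k j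
-- gives a position q = p + (j' - j) inside S carrying the same character
-- (lemma transport).  These positions form a new occurrence S[i₂..i₂+(e'-i')]
-- that contains j' (lemma shift-occurrence).

open import Defs
open import Data.Nat using (ℕ; _+_; _∸_; _≤_; _<_; _<?_; _≟_; zero; suc; s≤s; z≤n)
import Data.Nat.Properties as ℕP
open import Data.Fin using (Fin)
open import Data.Integer as ℤ using (ℤ; +_; -[1+_])
import Data.Integer.Properties as ℤP
open import Data.Integer.Tactic.RingSolver using (solve-∀)
open import Data.Maybe using (just)
open import Data.Product using (Σ; ∃; _×_; _,_; proj₁; proj₂)
open import Data.Sum using (inj₁; inj₂)
open import Data.Empty using (⊥-elim)
open import Relation.Nullary using (yes; no)
open import Relation.Binary.PropositionalEquality

diff-≤ : ∀ {a b c d} → a + d ≤ c + b → + a ℤ.- + b ℤ.≤ + c ℤ.- + d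
diff-≤ {a} {b} {c} {d} a+d≤c+b =
  subst₂ ℤ._≤_
    (trans (cong (ℤ._+ shift) (ℤP.pos-+ a d)) (cancelˡ (+ a) (+ d) (+ b)))
    (trans (cong (ℤ._+ shift) (ℤP.pos-+ c b)) (cancelʳ (+ c) (+ b) (+ d)))
    (ℤP.+-monoˡ-≤ shift (ℤ.+≤+ a+d≤c+b))
  where
  shift : ℤ
  shift = ℤ.- + b ℤ.- + d
  cancelˡ : ∀ x y z → (x ℤ.+ y) ℤ.+ (ℤ.- z ℤ.- y) ≡ x ℤ.- z
  cancelˡ = solve-∀
  cancelʳ : ∀ x y z → (x ℤ.+ y) ℤ.+ (ℤ.- y ℤ.- z) ≡ x ℤ.- z
  cancelʳ = solve-∀

copy-short : ∀ {k i e i' e'} → i ≤ e → e < i + k → i' ≤ e' → e' ∸ i' ≡ e ∸ i →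
  e' < i' + k
copy-short {k} {i} {e} {i'} {e'} i≤e e<i+k i'≤e' same-length =
  subst (_< i' + k) (ℕP.m+[n∸m]≡n i'≤e')
    (ℕP.+-monoʳ-< i' (subst (_< k) (sym same-length) length<k))
  where
  length<k : e ∸ i < k
  length<k = subst (e ∸ i <_) (ℕP.m+n∸m≡n i k) (ℕP.∸-monoˡ-< e<i+k i≤e)

near : ∀ {k j i' e' p} → i' ≤ j → j ≤ e' → e' < i' + k → i' ≤ p → p ≤ e' →
  j < p + k × p < j + k
near {k} i'≤j j≤e' e'<i'+k i'≤p p≤e' =
  ℕP.<-≤-trans (ℕP.≤-<-trans j≤e' e'<i'+k) (ℕP.+-monoˡ-≤ k i'≤p) ,
  ℕP.≤-<-trans p≤e' (ℕP.<-≤-trans e'<i'+k (ℕP.+-monoˡ-≤ k i'≤j))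

module _ {A : Set} {n : ℕ} (S : Fin n → A) where

  at-defined : ∀ {p} → 1 ≤ p → p ≤ n → ∃ λ x → at S p ≡ just x
  at-defined {suc p} _ p<n with p <? n
  ... | yes _ = _ , refl
  ... | no p≮n = ⊥-elim (p≮n p<n)

  ext-defined : ∀ {z x} → ext S z ≡ just x → ∃ λ q → z ≡ + q × 1 ≤ q × q ≤ n
  ext-defined {+ suc p} _ with p <? n
  ext-defined {+ suc p} _ | yes p<n = suc p , refl , s≤s z≤n , p<n
  ext-defined {+ suc p} () | no _
  ext-defined {+ zero} ()
  ext-defined { -[1+ _ ]} ()

  window-char : ∀ {k j j' p} → Equivₖ k S j' j → j < p + k → p < j + k →
    ext S (+ j' ℤ.+ (+ p ℤ.- + j)) ≡ at S p
  window-char {k} {j} {j'} {p} j'≡j j<p+k p<j+k =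
    trans (j'≡j (+ p ℤ.- + j) lower upper) (cong (ext S) (cancel (+ j) (+ p)))
    where
    lower : ℤ.- + k ℤ.+ + 1 ℤ.≤ + p ℤ.- + j
    lower = subst (ℤ._≤ _) (ℤP.+-comm (+ 1) (ℤ.- + k)) (diff-≤ {1} {k} {p} {j} j<p+k)
    upper : + p ℤ.- + j ℤ.≤ + k ℤ.- + 1
    upper = diff-≤ {p} {j} {k} {1} (subst₂ _≤_ (ℕP.+-comm 1 p) (ℕP.+-comm j k) p<j+k)
    cancel : ∀ y z → y ℤ.+ (z ℤ.- y) ≡ z
    cancel = solve-∀

  transport : ∀ {k j j' p} → Equivₖ k S j' j → j < p + k → p < j + k →
    1 ≤ p → p ≤ n → ∃ λ q → q + j ≡ j' + p × 1 ≤ q × q ≤ n × at S q ≡ at S p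
  transport {k} {j} {j'} {p} j'≡j j<p+k p<j+k 1≤p p≤n
    with at-defined 1≤p p≤n
  ... | _ , Sp≡x with ext-defined {+ j' ℤ.+ (+ p ℤ.- + j)} (trans (window-char j'≡j j<p+k p<j+k) Sp≡x)
  ... | q , q≡ , 1≤q , q≤n =
    q , offset , 1≤q , q≤n , trans (cong (ext S) (sym q≡)) (window-char j'≡j j<p+k p<j+k)
    where
    offset : q + j ≡ j' + p
    offset = ℤP.+-injective (begin
      + (q + j)                        ≡⟨ ℤP.pos-+ q j ⟩
      + q ℤ.+ + j                      ≡⟨ cong (ℤ._+ + j) (sym q≡) ⟩
      (+ j' ℤ.+ (+ p ℤ.- + j)) ℤ.+ + j ≡⟨ shift-back (+ j') (+ p) (+ j) ⟩
      + j' ℤ.+ + p                     ≡⟨ ℤP.pos-+ j' p ⟨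
      + (j' + p)                       ∎)
      where
      open ≡-Reasoning
      shift-back : ∀ x y z → (x ℤ.+ (y ℤ.- z)) ℤ.+ z ≡ x ℤ.+ y
      shift-back = solve-∀

  shift-occurrence : ∀ {k j j' i' e'} → Equivₖ k S j' j →
    1 ≤ i' → i' ≤ j → j ≤ e' → e' ≤ n → e' < i' + k →
    ∃ λ i₂ → 1 ≤ i₂ × i₂ ≤ j' × j' ≤ i₂ + (e' ∸ i') × i₂ + (e' ∸ i') ≤ n ×
      SameSubstring S i' e' i₂ (i₂ + (e' ∸ i'))
  shift-occurrence {k} {j} {j'} {i'} {e'} j'≡j 1≤i' i'≤j j≤e' e'≤n e'<i'+k
    with near i'≤j j≤e' e'<i'+k ℕP.≤-refl (ℕP.≤-trans i'≤j j≤e')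
  ... | j<i'+k , i'<j+k
    with transport j'≡j j<i'+k i'<j+k 1≤i' (ℕP.≤-trans (ℕP.≤-trans i'≤j j≤e') e'≤n)
  ... | i₂ , i₂+j≡j'+i' , 1≤i₂ , _ =
    i₂ , 1≤i₂ , i₂≤j' , j'≤end , proj₁ (copy L ℕP.≤-refl) ,
    (ℕP.m+n∸m≡n i₂ L , λ t t≤L → proj₂ (copy t t≤L))
    where
    open ≡-Reasoning
    L : ℕ
    L = e' ∸ i'
    i'+L≡e' : i' + L ≡ e'
    i'+L≡e' = ℕP.m+[n∸m]≡n (ℕP.≤-trans i'≤j j≤e')

    shifted : ∀ t → (i₂ + t) + j ≡ j' + (i' + t)
    shifted t = begin
      (i₂ + t) + j ≡⟨ ℕP.+-assoc i₂ t j ⟩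
      i₂ + (t + j) ≡⟨ cong (_+_ i₂) (ℕP.+-comm t j) ⟩
      i₂ + (j + t) ≡⟨ ℕP.+-assoc i₂ j t ⟨
      (i₂ + j) + t ≡⟨ cong (_+ t) i₂+j≡j'+i' ⟩
      (j' + i') + t ≡⟨ ℕP.+-assoc j' i' t ⟩
      j' + (i' + t) ∎

    i₂≤j' : i₂ ≤ j'
    i₂≤j' = ℕP.+-cancelʳ-≤ j i₂ j'
      (subst (_≤ j' + j) (sym i₂+j≡j'+i') (ℕP.+-monoʳ-≤ j' i'≤j))

    j'≤end : j' ≤ i₂ + L
    j'≤end = ℕP.+-cancelʳ-≤ j j' (i₂ + L)
      (subst (j' + j ≤_) (trans (cong (_+_ j') (sym i'+L≡e')) (sym (shifted L)))
        (ℕP.+-monoʳ-≤ j' j≤e'))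

    inside : ∀ t → t ≤ L → i' + t ≤ e'
    inside t t≤L = subst (i' + t ≤_) i'+L≡e' (ℕP.+-monoʳ-≤ i' t≤L)

    copy : ∀ t → t ≤ L → i₂ + t ≤ n × at S (i₂ + t) ≡ at S (i' + t)
    copy t t≤L with near i'≤j j≤e' e'<i'+k (ℕP.m≤m+n i' t) (inside t t≤L)
    ... | j<p+k , p<j+k
      with transport j'≡j j<p+k p<j+k (ℕP.≤-trans 1≤i' (ℕP.m≤m+n i' t))
             (ℕP.≤-trans (inside t t≤L) e'≤n)
    ... | q , q+j≡j'+p , _ , q≤n , Sq≡Sp =
      subst (_≤ n) q≡i₂+t q≤n , subst (λ r → at S r ≡ at S (i' + t)) q≡i₂+t Sq≡Sp
      where
      q≡i₂+t : q ≡ i₂ + t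
      q≡i₂+t = ℕP.+-cancelʳ-≡ j q (i₂ + t) (trans q+j≡j'+p (sym (shifted t)))

  same-trans : ∀ {i e i' e' i'' e''} → SameSubstring S i e i' e' →
    SameSubstring S i' e' i'' e'' → SameSubstring S i e i'' e''
  same-trans (same-length , same-chars) (same-length′ , same-chars′) =
    trans same-length′ same-length ,
    λ t t≤ → trans (same-chars′ t (subst (t ≤_) (sym same-length) t≤)) (same-chars t t≤)

  Hit : PosSet → ℕ → ℕ → Set
  Hit Γ i e = Σ ℕ λ i' → Σ ℕ λ e' → 1 ≤ i' × i' ≤ e' × e' ≤ n ×
    SameSubstring S i e i' e' × Σ ℕ λ g → Γ g × i' ≤ g × g ≤ e'

  -- If Γ hits a substring of length at most k, so does (Γ \ {j}) ∪ {j'} for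
  -- any j' ≡_k j: keep the occurrence unless its hit is j, else shift it.
  rehit : ∀ {k Γ j j' i e} → Equivₖ k S j' j → i ≤ e → e < i + k →
    Hit Γ i e → Hit (swapPos Γ j j') i e
  rehit {j = j} {j' = j'} {i = i} {e = e} j'≡j i≤e e<i+k
    (i' , e' , 1≤i' , i'≤e' , e'≤n , same@(same-length , _) , g , Γg , i'≤g , g≤e')
    with g ≟ j
  ... | no g≢j = i' , e' , 1≤i' , i'≤e' , e'≤n , same , g , inj₁ (Γg , g≢j) , i'≤g , g≤e'
  ... | yes refl =
    let (i₂ , 1≤i₂ , i₂≤j' , j'≤end , end≤n , copied) =
          shift-occurrence j'≡j 1≤i' i'≤g g≤e' e'≤n (copy-short i≤e e<i+k i'≤e' same-length)
    in i₂ , i₂ + (e' ∸ i') , 1≤i₂ , ℕP.m≤m+n i₂ (e' ∸ i') , end≤n ,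
       same-trans {i} {e} {i'} {e'} {i₂} {i₂ + (e' ∸ i')} same copied ,
       j' , inj₂ refl , i₂≤j' , j'≤end

lemma15 : {A : Set} (n : ℕ) (S : Fin n → A) (k : ℕ) → 1 ≤ k → (Γ : PosSet) →
    IsAttractor k S Γ → (j j' : ℕ) → Γ j → 1 ≤ j' → j' ≤ n → Equivₖ k S j' j →
    IsAttractor k S (swapPos Γ j j')
lemma15 n S k _ Γ (Γ⊆[1‥n] , Γ-hits) j j' _ 1≤j' j'≤n j'≡j = swap⊆[1‥n] , swap-hits
  where
  swap⊆[1‥n] : swapPos Γ j j' ⊆[1‥ n ]
  swap⊆[1‥n] p (inj₁ (Γp , _)) = Γ⊆[1‥n] p Γp
  swap⊆[1‥n] p (inj₂ refl) = 1≤j' , j'≤n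

  swap-hits : ∀ i e → 1 ≤ i → i ≤ e → e ≤ n → e < i + k → Hit S (swapPos Γ j j') i e
  swap-hits i e 1≤i i≤e e≤n e<i+k =
    rehit S j'≡j i≤e e<i+k (Γ-hits i e 1≤i i≤e e≤n e<i+k)
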